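{- Let $w\in\Sigma_n$ and let $\gamma$ be an increasing chain in the labeled Bruhat order from $w$ to $w_0$. Then: (1) if $u\xrightarrow{(k,b)}v$ is a labeled cover in $\gamma$, then $u^{ -1}v=(k,l)$ for some $l>k$; (2) the set of pairs $(k,b)$ with $k,b$ positive integers, $k+b\le n$, and $(k,b)$ not the label of a cover in $\gamma$, is an rc-graph.
   Context: $\Sigma_n$ is the symmetric group on $\{1,\dots,n\}$, $\ell(w)$ the number of inversions, $w_0=n\cdots21$, $s_a=(a,a{+}1)$. Bruhat covers: $u\lessdot v$ iff $v=u\cdot(k,l)$ (swapping positions $k<l$) with $u(k)<u(l)$ and no $k<i<l$ has $u(k)<u(i)<u(l)$. The labeled Bruhat order has an edge $u\xrightarrow{(k,b)}v$ whenever $u\lessdot v$, $u^{ -1}v=(i,j)$ with $i\le k<j$ and $b=u(i)=v(j)$. A chain $u_0\xrightarrow{(k_1,b_1)}u_1\to\cdots\xrightarrow{(k_m,b_m)}u_m$ is increasing if its labels strictly increase in lexicographic order ($(k,b)<(j,a)$ iff $k<j$, or $k=j$ and $b<a$). Let $P_n=\{(k,b)\in\mathbb{Z}_{>0}^2:k+b\le n\}$. For $R\subseteq P_n$ order its elements by $(k,b)\le(j,a)$ iff $k<j$, or $k=j$ and $b\ge a$; listing them in this order as $(k_1,b_1),\dots,(k_m,b_m)$, set $d(R)=(k_1+b_1-1,\dots,k_m+b_m-1)$. $R$ is an rc-graph (associated to $w$) if $d(R)$ is a reduced decomposition, i.e. $w=s_{k_1+b_1-1}\cdots s_{k_m+b_m-1}$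 with $m=\ell(w)$ for some (hence the) permutation $w$. -}

module Defs where

open import Data.Nat using (ℕ; zero; suc; _+_; _∸_; _≤_; _<_; _≡ᵇ_; _<?_)
open import Data.Nat.Properties using (_≟_)
open import Data.Bool using (if_then_else_)
open import Data.List using (List; []; _∷_; map; length; concatMap; downFrom; upTo; filter; foldl)
open import Data.List.Membership.Propositional using (_∈_)
import Data.Product.Properties
open import Data.List.Membership.DecPropositional (Data.Product.Properties.≡-dec _≟_ _≟_) renaming (_∈?_ to _∈ₚ?_)
  hiding (_∈_)
open import Data.List.Relation.Binary.Permutation.Propositional using (_↭_)
open import Data.List.Relation.Unary.Linked using (Linked)
open import Data.Product using (_×_; _,_; ∃; ∃-syntax; proj₁; proj₂)
open import Relation.Nullary using (¬_; ¬?)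
open import Relation.Binary.PropositionalEquality using (_≡_)

-- Permutations of {1,…,n} in one-line notation: the list [w(1), …, w(n)].
Perm : ℕ → List ℕ → Set
Perm n w = w ↭ map suc (upTo n)

idPerm : ℕ → List ℕ
idPerm n = map suc (upTo n)

w₀ : ℕ → List ℕ
w₀ n = map suc (downFrom n)

-- val u i = u(i)  (1-indexed; 0 outside the range)
val : List ℕ → ℕ → ℕ
val [] _ = 0
val (x ∷ xs) zero = 0
val (x ∷ xs) (suc zero) = x
val (x ∷ xs) (suc (suc i)) = val xs (suc i)

tr : ℕ → ℕ → ℕ → ℕ
tr k l i = if i ≡ᵇ k then l else (if i ≡ᵇ l then k else i)

-- swapPos k l u = u · (k,l)  (swap the entries in positions k and l)
swapPos : ℕ → ℕ → List ℕ → List ℕ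
swapPos k l u = map (λ i → val u (tr k l i)) (map suc (upTo (length u)))

inv : List ℕ → ℕ
inv [] = 0
inv (x ∷ xs) = length (filter (_<? x) xs) + inv xs

Cover : ℕ → List ℕ → List ℕ → Set
Cover n u v = Perm n u × Perm n v ×
  ∃[ k ] ∃[ l ] (1 ≤ k × k < l × l ≤ n × v ≡ swapPos k l u × val u k < val u l ×
    (∀ i → k < i → i < l → ¬ (val u k < val u i × val u i < val u l)))

LabEdge : ℕ → List ℕ → ℕ × ℕ → List ℕ → Set
LabEdge n u (k , b) v = Cover n u v ×
  ∃[ i ] ∃[ j ] (1 ≤ i × i < j × j ≤ n × v ≡ swapPos i j u ×
    i ≤ k × k < j × b ≡ val u i × b ≡ val v j)

Step : Set
Step = List ℕ × (ℕ × ℕ) × List ℕ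

label : Step → ℕ × ℕ
label (_ , kb , _) = kb

data IsChain (n : ℕ) : List ℕ → List ℕ → List Step → Set where
  nil  : ∀ {u} → IsChain n u u []
  cons : ∀ {u v z kb γ} → LabEdge n u kb v → IsChain n v z γ →
         IsChain n u z ((u , kb , v) ∷ γ)

data _<ₗ_ : ℕ × ℕ → ℕ × ℕ → Set where
  fst< : ∀ {k b j a} → k < j → (k , b) <ₗ (j , a)
  snd< : ∀ {k b a} → b < a → (k , b) <ₗ (k , a)

IncreasingChain : ℕ → List ℕ → List ℕ → List Step → Set
IncreasingChain n u z γ = IsChain n u z γ × Linked _<ₗ_ (map label γ)

-- P_n listed in the order (k,b) ≤ (j,a) iff k < j, or k = j and b ≥ a
orderedPn : ℕ → List (ℕ × ℕ)
orderedPn n = concatMap (λ k → map (λ b → (k , b)) (map suc (downFrom (n ∸ k)))) (map suc (upTo n))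

complementIn : ℕ → List (ℕ × ℕ) → List (ℕ × ℕ)
complementIn n L = filter (λ p → ¬? (p ∈ₚ? L)) (orderedPn n)

dWord : List (ℕ × ℕ) → List ℕ
dWord = map (λ { (k , b) → k + b ∸ 1 })

prodWord : ℕ → List ℕ → List ℕ
prodWord n = foldl (λ u a → swapPos a (suc a) u) (idPerm n)

IsReducedWord : ℕ → List ℕ → Set
IsReducedWord n word = ∃[ w ] (Perm n w × w ≡ prodWord n word × length word ≡ inv w)

IsRCGraph : ℕ → List (ℕ × ℕ) → Set
IsRCGraph n Rlist = IsReducedWord n (dWord Rlist)

-- Read the chain backwards from w₀. The complement of the empty set of labels is all of P_n,
-- whose word is the staircase reduced word of w₀. Stepping back along an edge v ← u labelled (k₁, b₁)
-- adds (k₁, b₁) to the labels, which deletes one letter s_c, c = k₁ + b₁ - 1, from the complement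
-- word. Since all later labels exceed (k₁, b₁), the cells of P_n before (k₁, b₁) are all present,
-- so the letters after s_c carry k₁ to c and the swapped position to c + 1; deleting s_c is then
-- right multiplication by the transposition of the edge, and the word stays reduced because a
-- cover raises the length by exactly one. Along the way, the positions before the current label
-- agree with w₀; this invariant forces every edge to swap at its label position k₁ and keeps the
-- labels inside P_n.

module Submission where

open import Defs
open import Data.Bool using (true; false)
open import Data.Empty using (⊥; ⊥-elim)
open import Data.List using (List; []; _∷_; [_]; map; length; upTo; downFrom; applyUpTo; foldl; _++_; concatMap; filter)
open import Data.List.Properties
  using (length-map; length-upTo; length-downFrom; length-++; map-++; map-∘; map-id; map-concatMap;
         ++-identityʳ; concatMap-++; concatMap-cong; filter-++; filter-accept; filter-reject; filter-all)
open import Data.List.Membership.Propositional using (_∈_)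
open import Data.List.Membership.Propositional.Properties using (∈-map⁻; ∈-upTo⁻)
open import Data.List.Relation.Binary.Permutation.Propositional as P using (_↭_; ↭-sym)
open import Data.List.Relation.Binary.Permutation.Propositional.Properties using (All-resp-↭; ↭-length)
open import Data.List.Relation.Unary.All as All using (All; []; _∷_)
import Data.List.Relation.Unary.All.Properties as AllP
open import Data.List.Relation.Unary.AllPairs using ([]; _∷_)
open import Data.List.Relation.Unary.Any using (here; there)
open import Data.List.Relation.Unary.Linked using (Linked; []; [-]; _∷_)
open import Data.List.Relation.Unary.Unique.Propositional using (Unique)
import Data.List.Relation.Unary.Unique.Propositional.Properties as Unique
open import Data.Nat
open import Data.Nat.Properties
open import Data.Nat.Solver using (module +-*-Solver)
open +-*-Solver
open import Data.Product using (_×_; _,_; ∃-syntax; proj₁; proj₂)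
import Data.Product.Properties
open import Data.Sum using (_⊎_; inj₁; inj₂)
open import Function using (id; _∘_; flip)
open import Relation.Binary.Definitions using (tri<; tri≈; tri>)
open import Relation.Binary.PropositionalEquality hiding ([_])
open import Relation.Nullary using (¬_; Dec; yes; no; ¬?)
open import Relation.Unary using (Decidable)
open import Data.List.Membership.DecPropositional (Data.Product.Properties.≡-dec _≟_ _≟_)
  using () renaming (_∈?_ to _∈ₚ?_)

-- Transpositions and words acting on positions

InRange : ℕ → ℕ → Set
InRange n p = 1 ≤ p × p ≤ n

ValidLetter : ℕ → ℕ → Set
ValidLetter n a = 1 ≤ a × suc a ≤ n

range : ℕ → ℕ → List ℕ
range s zero = []
range s (suc m) = s ∷ range (suc s) m

idPerm≡range : ∀ m → idPerm m ≡ range 1 m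
idPerm≡range m = go m id 0 (λ _ → refl)
  where
  go : ∀ m (f : ℕ → ℕ) s → (∀ i → f i ≡ s + i) → map suc (applyUpTo f m) ≡ range (suc s) m
  go zero f s h = refl
  go (suc m) f s h = cong₂ _∷_ (cong suc (trans (h 0) (+-identityʳ s)))
    (go m (f ∘ suc) (suc s) (λ i → trans (h (suc i)) (+-suc s i)))

val-map-range : ∀ (g : ℕ → ℕ) m s i → i < m → val (map g (range s m)) (suc i) ≡ g (s + i)
val-map-range g (suc m) s zero _ = cong g (sym (+-identityʳ s))
val-map-range g (suc m) s (suc i) (s≤s i<m) = trans (val-map-range g m (suc s) i i<m) (cong g (sym (+-suc s i)))

val-map-idPerm : ∀ (g : ℕ → ℕ) m i → 1 ≤ i → i ≤ m → val (map g (idPerm m)) i ≡ g i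
val-map-idPerm g m (suc i) _ i≤m rewrite idPerm≡range m = val-map-range g m 1 i i≤m

length-idPerm : ∀ m → length (idPerm m) ≡ m
length-idPerm m = trans (length-map suc (upTo m)) (length-upTo m)

val-idPerm : ∀ n i → InRange n i → val (idPerm n) i ≡ i
val-idPerm n i (1≤i , i≤n) = trans (cong (λ l → val l i) (sym (map-id (idPerm n)))) (val-map-idPerm id n i 1≤i i≤n)

≡-from-val : ∀ (xs ys : List ℕ) → length xs ≡ length ys →
  (∀ i → 1 ≤ i → i ≤ length xs → val xs i ≡ val ys i) → xs ≡ ys
≡-from-val [] [] _ _ = refl
≡-from-val (x ∷ xs) (y ∷ ys) eq h =
  cong₂ _∷_ (h 1 (s≤s z≤n) (s≤s z≤n))
    (≡-from-val xs ys (suc-injective eq) λ { (suc i) _ i≤ → h (suc (suc i)) (s≤s z≤n) (s≤s i≤) })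

≡ᵇ-true : ∀ i → (i ≡ᵇ i) ≡ true
≡ᵇ-true i with i ≡ᵇ i | ≡⇒≡ᵇ i i refl
... | true | _ = refl

≡ᵇ-false : ∀ {i k} → i ≢ k → (i ≡ᵇ k) ≡ false
≡ᵇ-false {i} {k} i≢k with i ≡ᵇ k | ≡ᵇ⇒≡ i k
... | false | _ = refl
... | true | sound = ⊥-elim (i≢k (sound _))

tr-left : ∀ k l → tr k l k ≡ l
tr-left k l rewrite ≡ᵇ-true k = refl

tr-right : ∀ k l → tr k l l ≡ k
tr-right k l with l ≟ k
... | yes refl rewrite ≡ᵇ-true l = refl
... | no l≢k rewrite ≡ᵇ-false l≢k | ≡ᵇ-true l = refl

tr-other : ∀ k l i → i ≢ k → i ≢ l → tr k l i ≡ i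
tr-other k l i i≢k i≢l rewrite ≡ᵇ-false i≢k | ≡ᵇ-false i≢l = refl

tr-involutive : ∀ k l i → tr k l (tr k l i) ≡ i
tr-involutive k l i with i ≟ k | i ≟ l
... | yes refl | _ = trans (cong (tr k l) (tr-left k l)) (tr-right k l)
... | no ik | yes refl = trans (cong (tr k l) (tr-right k l)) (tr-left k l)
... | no ik | no il = trans (cong (tr k l) (tr-other k l i ik il)) (tr-other k l i ik il)

tr-injective : ∀ k l {i j} → tr k l i ≡ tr k l j → i ≡ j
tr-injective k l {i} {j} e = trans (sym (tr-involutive k l i)) (trans (cong (tr k l) e) (tr-involutive k l j))

tr-InRange : ∀ {n k l i} → InRange n k → InRange n l → InRange n i → InRange n (tr k l i)
tr-InRange {n} {k} {l} {i} rk rl ri with i ≟ k | i ≟ l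
... | yes refl | _ = subst (InRange n) (sym (tr-left i l)) rl
... | no _ | yes refl = subst (InRange n) (sym (tr-right k i)) rk
... | no a | no b = subst (InRange n) (sym (tr-other k l i a b)) ri

length-swapPos : ∀ k l u → length (swapPos k l u) ≡ length u
length-swapPos k l u = trans (length-map _ (idPerm (length u))) (length-idPerm (length u))

val-swapPos : ∀ k l u i → 1 ≤ i → i ≤ length u → val (swapPos k l u) i ≡ val u (tr k l i)
val-swapPos k l u i = val-map-idPerm (λ i → val u (tr k l i)) (length u) i

applyWord : List ℕ → ℕ → ℕ
applyWord [] i = i
applyWord (a ∷ as) i = tr a (suc a) (applyWord as i)

applyWord-++ : ∀ xs ys i → applyWord (xs ++ ys) i ≡ applyWord xs (applyWord ys i)
applyWord-++ [] ys i = refl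
applyWord-++ (a ∷ xs) ys i = cong (tr a (suc a)) (applyWord-++ xs ys i)

applyWord-injective : ∀ ws {p q} → applyWord ws p ≡ applyWord ws q → p ≡ q
applyWord-injective [] e = e
applyWord-injective (a ∷ ws) e = applyWord-injective ws (tr-injective a (suc a) e)

applyWord-fixes-below : ∀ m ws → All (m <_) ws → ∀ p → p ≤ m → applyWord ws p ≡ p
applyWord-fixes-below m [] _ p _ = refl
applyWord-fixes-below m (a ∷ ws) (m<a ∷ h) p p≤m = trans (cong (tr a (suc a)) (applyWord-fixes-below m ws h p p≤m))
  (tr-other a (suc a) p (<⇒≢ (≤-<-trans p≤m m<a)) (<⇒≢ (≤-<-trans p≤m (m<n⇒m<1+n m<a))))

applyWord-fixes-above : ∀ ws p → All (λ a → suc a < p) ws → applyWord ws p ≡ p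
applyWord-fixes-above [] p _ = refl
applyWord-fixes-above (a ∷ ws) p (h ∷ hs) = trans (cong (tr a (suc a)) (applyWord-fixes-above ws p hs))
  (tr-other a (suc a) p (λ q → <-irrefl (sym q) (<-trans (n<1+n a) h)) (λ q → <-irrefl (sym q) h))

applyWord-InRange : ∀ n ws → All (ValidLetter n) ws → ∀ p → InRange n p → InRange n (applyWord ws p)
applyWord-InRange n [] _ p h = h
applyWord-InRange n (a ∷ ws) ((1≤a , a<n) ∷ gs) p h =
  tr-InRange (1≤a , <⇒≤ a<n) (s≤s z≤n , a<n) (applyWord-InRange n ws gs p h)

applyLetter : List ℕ → ℕ → List ℕ
applyLetter u a = swapPos a (suc a) u

length-foldl-applyLetter : ∀ ws u → length (foldl applyLetter u ws) ≡ length u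
length-foldl-applyLetter [] u = refl
length-foldl-applyLetter (a ∷ ws) u = trans (length-foldl-applyLetter ws (applyLetter u a)) (length-swapPos a (suc a) u)

val-foldl-applyLetter : ∀ n ws u → length u ≡ n → All (ValidLetter n) ws → ∀ i → InRange n i →
  val (foldl applyLetter u ws) i ≡ val u (applyWord ws i)
val-foldl-applyLetter n [] u _ _ i _ = refl
val-foldl-applyLetter n (a ∷ ws) u lu (g ∷ gs) i h =
  let (q1 , q2) = applyWord-InRange n ws gs i h in
  trans (val-foldl-applyLetter n ws (applyLetter u a) (trans (length-swapPos a (suc a) u) lu) gs i h)
        (val-swapPos a (suc a) u (applyWord ws i) q1 (subst (applyWord ws i ≤_) (sym lu) q2))

≡prodWord : ∀ n ws (u : List ℕ) → length u ≡ n → All (ValidLetter n) ws →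
  (∀ i → InRange n i → val u i ≡ applyWord ws i) → u ≡ prodWord n ws
≡prodWord n ws u lu gs h =
  ≡-from-val u (prodWord n ws)
    (trans lu (sym (trans (length-foldl-applyLetter ws (idPerm n)) (length-idPerm n))))
    λ i i1 i2 → let r = (i1 , subst (i ≤_) lu i2) in
      trans (h i r) (sym (trans (val-foldl-applyLetter n ws (idPerm n) (length-idPerm n) gs i r)
                                (val-idPerm n (applyWord ws i) (applyWord-InRange n ws gs i r))))

-- Permutations in one-line notation

Unique-resp-↭ : ∀ {A : Set} {xs ys : List A} → xs ↭ ys → Unique xs → Unique ys
Unique-resp-↭ P.refl u = u
Unique-resp-↭ (P.prep x p) (a ∷ u) = All-resp-↭ p a ∷ Unique-resp-↭ p u
Unique-resp-↭ (P.swap x y p) ((xy ∷ ax) ∷ (ay ∷ u)) =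
  ((λ e → xy (sym e)) ∷ All-resp-↭ p ay) ∷ (All-resp-↭ p ax ∷ Unique-resp-↭ p u)
Unique-resp-↭ (P.trans p q) u = Unique-resp-↭ q (Unique-resp-↭ p u)

Perm-length : ∀ {n u} → Perm n u → length u ≡ n
Perm-length {n} p = trans (↭-length p) (length-idPerm n)

Perm-unique : ∀ {n u} → Perm n u → Unique u
Perm-unique {n} p = Unique-resp-↭ (↭-sym p) (Unique.map⁺ suc-injective (Unique.upTo⁺ n))

Perm-InRange : ∀ {n u} → Perm n u → All (InRange n) u
Perm-InRange {n} p = All-resp-↭ (↭-sym p) (All.tabulate inRange)
  where
  inRange : ∀ {x} → x ∈ idPerm n → InRange n x
  inRange x∈ with ∈-map⁻ suc x∈
  ... | i , i∈ , refl = s≤s z≤n , ∈-upTo⁻ i∈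

val-All : ∀ {P : ℕ → Set} xs → All P xs → ∀ i → 1 ≤ i → i ≤ length xs → P (val xs i)
val-All (x ∷ xs) (px ∷ _) (suc zero) _ _ = px
val-All (x ∷ xs) (_ ∷ h) (suc (suc i)) _ (s≤s le) = val-All xs h (suc i) (s≤s z≤n) le

val-Unique : ∀ xs → Unique xs → ∀ i j → 1 ≤ i → i < j → j ≤ length xs → val xs i ≢ val xs j
val-Unique (x ∷ xs) (a ∷ u) (suc zero) (suc zero) _ (s≤s ()) _
val-Unique (x ∷ xs) (a ∷ u) (suc zero) (suc (suc j)) _ _ (s≤s le) = val-All xs a (suc j) (s≤s z≤n) le
val-Unique (x ∷ xs) (a ∷ u) (suc (suc i)) (suc (suc j)) _ (s≤s lt) (s≤s le) =
  val-Unique xs u (suc i) (suc j) (s≤s z≤n) lt le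

record PermVals (n : ℕ) (u : List ℕ) : Set where
  field
    length≡ : length u ≡ n
    val-InRange : ∀ i → InRange n i → InRange n (val u i)
    val-injective : ∀ i j → InRange n i → InRange n j → i ≢ j → val u i ≢ val u j

permVals : ∀ {n u} → Perm n u → PermVals n u
permVals {n} {u} p = record
  { length≡ = Perm-length p
  ; val-InRange = λ i (h1 , h2) → val-All u (Perm-InRange p) i h1 (≤len h2)
  ; val-injective = injective }
  where
  ≤len : ∀ {i} → i ≤ n → i ≤ length u
  ≤len = subst (_ ≤_) (sym (Perm-length p))
  injective : ∀ i j → InRange n i → InRange n j → i ≢ j → val u i ≢ val u j
  injective i j (i1 , i2) (j1 , j2) ne with <-cmp i j
  ... | tri< lt _ _ = val-Unique u (Perm-unique p) i j i1 lt (≤len j2)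
  ... | tri≈ _ e _ = ⊥-elim (ne e)
  ... | tri> _ _ gt = λ e → val-Unique u (Perm-unique p) j i j1 gt (≤len i2) (sym e)

NoValueBetween : List ℕ → ℕ → ℕ → Set
NoValueBetween u k l = ∀ i → k < i → i < l → ¬ (val u k < val u i × val u i < val u l)

module SwapVals {n : ℕ} {u v : List ℕ} {i j : ℕ} (pu : PermVals n u) (ev : v ≡ swapPos i j u) where
  open PermVals pu

  val-swap : ∀ p → InRange n p → val v p ≡ val u (tr i j p)
  val-swap p (p1 , p2) = trans (cong (λ w → val w p) ev) (val-swapPos i j u p p1 (subst (p ≤_) (sym length≡) p2))

  val-swap-i : InRange n i → val v i ≡ val u j
  val-swap-i r = trans (val-swap i r) (cong (val u) (tr-left i j))

  val-swap-j : InRange n j → val v j ≡ val u i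
  val-swap-j r = trans (val-swap j r) (cong (val u) (tr-right i j))

  val-swap-other : ∀ p → InRange n p → p ≢ i → p ≢ j → val v p ≡ val u p
  val-swap-other p r a b = trans (val-swap p r) (cong (val u) (tr-other i j p a b))

swapPos-injective : ∀ {n u i j k l} → PermVals n u → InRange n i → InRange n j → InRange n k → InRange n l →
  i < j → k < l → swapPos i j u ≡ swapPos k l u → i ≡ k × j ≡ l
swapPos-injective {n} {u} {i} {j} {k} {l} pu ri rj rk rl ij kl e = i≡k , j≡l
  where
  open PermVals pu
  module A = SwapVals {n} {u} {swapPos i j u} {i} {j} pu refl
  module B = SwapVals {n} {u} {swapPos i j u} {k} {l} pu e
  i↦j : val u (tr k l i) ≡ val u j
  i↦j = trans (sym (B.val-swap i ri)) (A.val-swap-i ri)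
  i≡k : i ≡ k
  i≡k with i ≟ k | i ≟ l
  ... | yes i≡k | _ = i≡k
  ... | no _ | yes refl with tr k l l ≟ j
  ...   | yes k≡j = ⊥-elim (<-asym ij (subst (_< l) (trans (sym (tr-right k l)) k≡j) kl))
  ...   | no k≢j = ⊥-elim (val-injective (tr k l l) j (subst (InRange n) (sym (tr-right k l)) rk) rj k≢j i↦j)
  i≡k | no i≢k | no i≢l =
    ⊥-elim (val-injective i j ri rj (<⇒≢ ij) (trans (sym (cong (val u) (tr-other k l i i≢k i≢l))) i↦j))
  j≡l : j ≡ l
  j≡l with j ≟ l
  ... | yes j≡l = j≡l
  ... | no j≢l = ⊥-elim (val-injective l k rl rk (λ q → <-irrefl (sym q) kl)
          (trans (sym (A.val-swap-other l rl (λ q → <-irrefl (trans (sym i≡k) (sym q)) kl) (j≢l ∘ sym)))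
            (trans (B.val-swap l rl) (cong (val u) (tr-right k l)))))

-- A Bruhat cover raises the number of inversions by one

splitAt-position : ∀ {A : Set} (xs : List A) i → i < length xs → ∃[ P ] ∃[ y ] ∃[ Q ] (xs ≡ P ++ y ∷ Q × length P ≡ i)
splitAt-position (x ∷ xs) zero _ = [] , x , xs , refl , refl
splitAt-position (x ∷ xs) (suc i) (s≤s lt) with splitAt-position xs i lt
... | P , y , Q , e , l = x ∷ P , y , Q , cong (x ∷_) e , cong suc l

val-++ʳ : ∀ (P R : List ℕ) i → 1 ≤ i → val (P ++ R) (length P + i) ≡ val R i
val-++ʳ [] R i _ = refl
val-++ʳ (p ∷ P) R (suc i) _ = begin
  val (p ∷ P ++ R) (suc (length P + suc i)) ≡⟨ cong (λ t → val (p ∷ P ++ R) (suc t)) (+-suc (length P) i) ⟩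
  val (P ++ R) (suc (length P + i))         ≡⟨ cong (val (P ++ R)) (sym (+-suc (length P) i)) ⟩
  val (P ++ R) (length P + suc i)           ≡⟨ val-++ʳ P R (suc i) (s≤s z≤n) ⟩
  val R (suc i)                             ∎
  where open ≡-Reasoning

val-++ˡ : ∀ (M T : List ℕ) i → i ≤ length M → val (M ++ T) i ≡ val M i
val-++ˡ [] [] zero _ = refl
val-++ˡ [] (t ∷ T) zero _ = refl
val-++ˡ (m ∷ M) T zero _ = refl
val-++ˡ (m ∷ M) T (suc zero) _ = refl
val-++ˡ (m ∷ M) T (suc (suc i)) (s≤s le) = val-++ˡ M T (suc i) le

∈⇒val : ∀ {y} (M : List ℕ) → y ∈ M → ∃[ j ] (j < length M × val M (suc j) ≡ y)
∈⇒val (m ∷ M) (here refl) = 0 , s≤s z≤n , refl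
∈⇒val (m ∷ M) (there h) with ∈⇒val M h
... | j , lt , e = suc j , s≤s lt , e

tr-suc : ∀ a b j → tr (suc a) (suc b) (suc j) ≡ suc (tr a b j)
tr-suc a b j with j ≡ᵇ a
... | true = refl
... | false with j ≡ᵇ b
...   | true = refl
...   | false = refl

val-replace-other : ∀ (M S : List ℕ) a b j → j ≢ length M → val (M ++ a ∷ S) (suc j) ≡ val (M ++ b ∷ S) (suc j)
val-replace-other M S a b j ne with <-cmp j (length M)
... | tri< lt _ _ = trans (val-++ˡ M _ (suc j) lt) (sym (val-++ˡ M _ (suc j) lt))
... | tri≈ _ e _ = ⊥-elim (ne e)
... | tri> _ _ gt = trans (cong (val (M ++ a ∷ S)) (sym eq)) (trans (val-++ʳ M (a ∷ S) (suc (suc d)) (s≤s z≤n))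
                     (sym (trans (cong (val (M ++ b ∷ S)) (sym eq)) (val-++ʳ M (b ∷ S) (suc (suc d)) (s≤s z≤n)))))
  where
  d : ℕ
  d = j ∸ suc (length M)
  eq : length M + suc (suc d) ≡ suc j
  eq = trans (+-suc (length M) (suc d)) (cong suc (trans (+-suc (length M) d) (m+[n∸m]≡n gt)))

val-block-first : ∀ P x (R : List ℕ) → val (P ++ x ∷ R) (suc (length P)) ≡ x
val-block-first P x R = trans (cong (val (P ++ x ∷ R)) (+-comm 1 (length P))) (val-++ʳ P (x ∷ R) 1 (s≤s z≤n))

val-swap-blocks : ∀ P x M z S i → val (P ++ z ∷ M ++ x ∷ S) i ≡
  val (P ++ x ∷ M ++ z ∷ S) (tr (suc (length P)) (suc (length P) + suc (length M)) i)
val-swap-blocks [] x M z [] zero = refl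
val-swap-blocks [] x M z (s ∷ S) zero = refl
val-swap-blocks [] x M z S (suc zero) =
  sym (trans (cong (val (x ∷ M ++ z ∷ S)) (tr-left 1 (suc (suc (length M)))))
             (val-block-first M z S))
val-swap-blocks [] x M z S (suc (suc j)) with j ≟ length M
... | yes refl = trans (val-block-first M x S) (sym (cong (val (x ∷ M ++ z ∷ S)) (tr-right 1 (suc (suc (length M))))))
... | no j≢M = trans (val-replace-other M S x z j j≢M) (sym (cong (val (x ∷ M ++ z ∷ S)) fixed))
  where
  fixed : tr 1 (suc (suc (length M))) (suc (suc j)) ≡ suc (suc j)
  fixed = trans (tr-suc 0 (suc (length M)) (suc j))
                (cong suc (tr-other 0 (suc (length M)) (suc j) (λ ()) (j≢M ∘ suc-injective)))
val-swap-blocks (p ∷ P) x M z S zero = refl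
val-swap-blocks (p ∷ P) x M z S (suc zero) = refl
val-swap-blocks (p ∷ P) x M z S (suc (suc j)) =
  trans (val-swap-blocks P x M z S (suc j)) (sym shifted)
  where
  U = P ++ x ∷ M ++ z ∷ S
  k = suc (length P)
  l = suc (length P) + suc (length M)
  shifted : val (p ∷ U) (tr (suc k) (suc l) (suc (suc j))) ≡ val U (tr k l (suc j))
  shifted = begin
    val (p ∷ U) (tr (suc k) (suc l) (suc (suc j)))
      ≡⟨ cong (val (p ∷ U)) (tr-suc k l (suc j)) ⟩
    val (p ∷ U) (suc (tr k l (suc j)))
      ≡⟨ cong (λ t → val (p ∷ U) (suc t)) (tr-suc (length P) (length P + suc (length M)) j) ⟩
    val U (suc (tr (length P) (length P + suc (length M)) j))
      ≡⟨ cong (val U) (sym (tr-suc (length P) (length P + suc (length M)) j)) ⟩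
    val U (tr k l (suc j)) ∎
    where open ≡-Reasoning

countBelow : ℕ → List ℕ → ℕ
countBelow y xs = length (filter (_<? y) xs)

countBelow-++ : ∀ y A B → countBelow y (A ++ B) ≡ countBelow y A + countBelow y B
countBelow-++ y A B = trans (cong length (filter-++ (_<? y) A B)) (length-++ (filter (_<? y) A))

countBelow-accept : ∀ {y a} R → a < y → countBelow y (a ∷ R) ≡ suc (countBelow y R)
countBelow-accept {y} R h = cong length (filter-accept (_<? y) h)

countBelow-reject : ∀ {y a} R → ¬ a < y → countBelow y (a ∷ R) ≡ countBelow y R
countBelow-reject {y} R h = cong length (filter-reject (_<? y) h)

countBelow-outside-head : ∀ {x z y} R R′ → x < z → y < x ⊎ z < y →
  ∃[ δ ] (countBelow z (y ∷ R) ≡ δ + countBelow z R × countBelow x (y ∷ R′) ≡ δ + countBelow x R′)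
countBelow-outside-head R R′ x<z (inj₁ y<x) = 1 , countBelow-accept R (<-trans y<x x<z) , countBelow-accept R′ y<x
countBelow-outside-head R R′ x<z (inj₂ z<y) =
  0 , countBelow-reject R (<-asym z<y) , countBelow-reject R′ (<-asym (<-trans x<z z<y))

countBelow-outside : ∀ {x z y} S → x < z → y < x ⊎ z < y → countBelow y (x ∷ S) ≡ countBelow y (z ∷ S)
countBelow-outside S x<z (inj₁ y<x) =
  trans (countBelow-reject S (<-asym y<x)) (sym (countBelow-reject S (<-asym (<-trans y<x x<z))))
countBelow-outside S x<z (inj₂ z<y) =
  trans (countBelow-accept S (<-trans x<z z<y)) (sym (countBelow-accept S z<y))

+-shift-suc : ∀ δ K a b c d → a + b ≡ suc (c + d) → (δ + a) + (K + b) ≡ suc ((δ + c) + (K + d))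
+-shift-suc δ K a b c d h = begin
  (δ + a) + (K + b)     ≡⟨ solve 4 (λ δ K a b → (δ :+ a) :+ (K :+ b) := (δ :+ K) :+ (a :+ b)) refl δ K a b ⟩
  (δ + K) + (a + b)     ≡⟨ cong ((δ + K) +_) h ⟩
  (δ + K) + suc (c + d)
    ≡⟨ solve 4 (λ δ K c d → (δ :+ K) :+ (con 1 :+ (c :+ d)) := con 1 :+ ((δ :+ c) :+ (K :+ d))) refl δ K c d ⟩
  suc ((δ + c) + (K + d)) ∎
  where open ≡-Reasoning

inv-swap-block-ends : ∀ x z S M → x < z → All (λ y → y < x ⊎ z < y) M →
  inv (z ∷ M ++ x ∷ S) ≡ suc (inv (x ∷ M ++ z ∷ S))
inv-swap-block-ends x z S [] x<z [] = begin
  countBelow z (x ∷ S) + (countBelow x S + inv S)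
    ≡⟨ cong (_+ (countBelow x S + inv S)) (countBelow-accept S x<z) ⟩
  suc (countBelow z S) + (countBelow x S + inv S)
    ≡⟨ solve 3 (λ a b c → (con 1 :+ a) :+ (b :+ c) := con 1 :+ (b :+ (a :+ c))) refl
               (countBelow z S) (countBelow x S) (inv S) ⟩
  suc (countBelow x S + (countBelow z S + inv S))
    ≡⟨ cong (λ t → suc (t + (countBelow z S + inv S))) (sym (countBelow-reject S (<-asym x<z))) ⟩
  suc (countBelow x (z ∷ S) + (countBelow z S + inv S)) ∎
  where open ≡-Reasoning
inv-swap-block-ends x z S (y ∷ M) x<z (outside ∷ outsides)
  with countBelow-outside-head (M ++ x ∷ S) (M ++ z ∷ S) x<z outside
... | δ , z-head , x-head = begin
  countBelow z (y ∷ Mx) + (countBelow y Mx + inv Mx)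
    ≡⟨ cong₂ (λ p q → p + (q + inv Mx)) z-head y-same ⟩
  (δ + countBelow z Mx) + (countBelow y Mz + inv Mx)
    ≡⟨ +-shift-suc δ (countBelow y Mz) _ _ _ _ (inv-swap-block-ends x z S M x<z outsides) ⟩
  suc ((δ + countBelow x Mz) + (countBelow y Mz + inv Mz))
    ≡⟨ cong (λ p → suc (p + (countBelow y Mz + inv Mz))) (sym x-head) ⟩
  suc (countBelow x (y ∷ Mz) + (countBelow y Mz + inv Mz)) ∎
  where
  open ≡-Reasoning
  Mx = M ++ x ∷ S
  Mz = M ++ z ∷ S
  y-same : countBelow y Mx ≡ countBelow y Mz
  y-same = trans (countBelow-++ y M (x ∷ S))
             (trans (cong (countBelow y M +_) (countBelow-outside S x<z outside)) (sym (countBelow-++ y M (z ∷ S))))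

inv-prefix-suc : ∀ P L L′ → (∀ y → countBelow y L ≡ countBelow y L′) → inv L′ ≡ suc (inv L) →
  inv (P ++ L′) ≡ suc (inv (P ++ L))
inv-prefix-suc [] L L′ same step = step
inv-prefix-suc (p ∷ P) L L′ same step = begin
  countBelow p (P ++ L′) + inv (P ++ L′)
    ≡⟨ cong₂ _+_ (trans (countBelow-++ p P L′) (cong (countBelow p P +_) (sym (same p))))
                 (inv-prefix-suc P L L′ same step) ⟩
  (countBelow p P + countBelow p L) + suc (inv (P ++ L))
    ≡⟨ +-suc _ _ ⟩
  suc ((countBelow p P + countBelow p L) + inv (P ++ L))
    ≡⟨ cong (λ t → suc (t + inv (P ++ L))) (sym (countBelow-++ p P L)) ⟩
  suc (countBelow p (P ++ L) + inv (P ++ L)) ∎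
  where open ≡-Reasoning

countBelow-blocks : ∀ y x M z S →
  countBelow y (x ∷ M ++ z ∷ S) ≡ countBelow y [ x ] + (countBelow y M + (countBelow y [ z ] + countBelow y S))
countBelow-blocks y x M z S =
  trans (countBelow-++ y [ x ] (M ++ z ∷ S))
    (cong (countBelow y [ x ] +_) (trans (countBelow-++ y M (z ∷ S)) (cong (countBelow y M +_) (countBelow-++ y [ z ] S))))

countBelow-swap-block-ends : ∀ y x M z S → countBelow y (x ∷ M ++ z ∷ S) ≡ countBelow y (z ∷ M ++ x ∷ S)
countBelow-swap-block-ends y x M z S =
  trans (countBelow-blocks y x M z S)
    (trans (solve 4 (λ a b c d → a :+ (b :+ (c :+ d)) := c :+ (b :+ (a :+ d))) refl
                    (countBelow y [ x ]) (countBelow y M) (countBelow y [ z ]) (countBelow y S))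
           (sym (countBelow-blocks y z M x S)))

Unique-dropPrefix : ∀ {A : Set} (P R : List A) → Unique (P ++ R) → Unique R
Unique-dropPrefix [] R u = u
Unique-dropPrefix (p ∷ P) R (_ ∷ u) = Unique-dropPrefix P R u

Unique-before : ∀ {A : Set} (M S : List A) z → Unique (M ++ z ∷ S) → All (λ y → y ≢ z) M
Unique-before [] S z _ = []
Unique-before (m ∷ M) S z (a ∷ u) = hd (AllP.++⁻ʳ M {z ∷ S} a) ∷ Unique-before M S z u
  where
  hd : All (λ y → m ≢ y) (z ∷ S) → m ≢ z
  hd (h ∷ _) = h

Blocks : List ℕ → ℕ → ℕ → Set
Blocks u k l = ∃[ P ] ∃[ x ] ∃[ M ] ∃[ z ] ∃[ S ]
  (u ≡ P ++ x ∷ M ++ z ∷ S × suc (length P) ≡ k × suc (length P) + suc (length M) ≡ l)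

blocks : ∀ u k l → 1 ≤ k → k < l → l ≤ length u → Blocks u k l
blocks u (suc k) l _ k<l l≤u with splitAt-position u k (≤-trans (≤-trans (n≤1+n (suc k)) k<l) l≤u)
... | P , x , R , refl , refl with splitAt-position R (l ∸ suc (suc (length P))) d<R
  where
  d<R : l ∸ suc (suc (length P)) < length R
  d<R = +-cancelˡ-≤ (suc (length P)) _ _
          (≤-trans (≤-reflexive (trans (+-suc (suc (length P)) (l ∸ suc (suc (length P)))) (m+[n∸m]≡n k<l)))
            (≤-trans l≤u (≤-reflexive (trans (length-++ P) (+-suc (length P) (length R))))))
... | M , z , S , refl , |M|≡d = P , x , M , z , S , refl , refl ,
  trans (cong (λ t → suc (length P) + suc t) |M|≡d)
        (trans (+-suc (suc (length P)) (l ∸ suc (suc (length P)))) (m+[n∸m]≡n k<l))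

val-block-middle : ∀ P x M (R : List ℕ) j → val (P ++ x ∷ M ++ R) (suc (length P) + suc j) ≡ val (M ++ R) (suc j)
val-block-middle P x M R j =
  trans (cong (val (P ++ x ∷ M ++ R)) (sym (+-suc (length P) (suc j)))) (val-++ʳ P (x ∷ M ++ R) (suc (suc j)) (s≤s z≤n))

val-block-second : ∀ P x M z (S : List ℕ) → val (P ++ x ∷ M ++ z ∷ S) (suc (length P) + suc (length M)) ≡ z
val-block-second P x M z S = trans (val-block-middle P x M (z ∷ S) (length M)) (val-block-first M z S)

swapPos-blocks : ∀ P x M z S →
  swapPos (suc (length P)) (suc (length P) + suc (length M)) (P ++ x ∷ M ++ z ∷ S) ≡ P ++ z ∷ M ++ x ∷ S
swapPos-blocks P x M z S = ≡-from-val _ _ (trans (length-swapPos _ _ U) length-swapped)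
  λ i 1≤i i≤ → trans (val-swapPos _ _ U i 1≤i (subst (i ≤_) (length-swapPos _ _ U) i≤))
                     (sym (val-swap-blocks P x M z S i))
  where
  U = P ++ x ∷ M ++ z ∷ S
  length-swapped : length U ≡ length (P ++ z ∷ M ++ x ∷ S)
  length-swapped = begin
    length U                                ≡⟨ length-++ P ⟩
    length P + suc (length (M ++ z ∷ S))   ≡⟨ cong (λ t → length P + suc t) (length-++ M) ⟩
    length P + suc (length M + suc (length S)) ≡⟨ cong (λ t → length P + suc t) (sym (length-++ M)) ⟩
    length P + suc (length (M ++ x ∷ S))   ≡⟨ sym (length-++ P) ⟩
    length (P ++ z ∷ M ++ x ∷ S)            ∎
    where open ≡-Reasoning

cover-middle-outside : ∀ P x M z S → Unique (P ++ x ∷ M ++ z ∷ S) →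
  NoValueBetween (P ++ x ∷ M ++ z ∷ S) (suc (length P)) (suc (length P) + suc (length M)) →
  All (λ y → y < x ⊎ z < y) M
cover-middle-outside P x M z S uq between = All.tabulate (λ {y} y∈M → outside y y∈M)
  where
  U = P ++ x ∷ M ++ z ∷ S
  x∉M : All (x ≢_) M
  x∉M with Unique-dropPrefix P _ uq
  ... | x∉ ∷ _ = AllP.++⁻ˡ M x∉
  z∉M : All (_≢ z) M
  z∉M with Unique-dropPrefix P _ uq
  ... | _ ∷ rest = Unique-before M S z rest
  outside : ∀ y → y ∈ M → y < x ⊎ z < y
  outside y y∈M with ∈⇒val M y∈M
  ... | j , j<M , refl with <-cmp (val M (suc j)) x | <-cmp (val M (suc j)) z
  ... | tri< y<x _ _ | _ = inj₁ y<x
  ... | tri≈ _ y≡x _ | _ = ⊥-elim (All.lookup x∉M y∈M (sym y≡x))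
  ... | tri> _ _ _ | tri≈ _ y≡z _ = ⊥-elim (All.lookup z∉M y∈M y≡z)
  ... | tri> _ _ _ | tri> _ _ z<y = inj₂ z<y
  ... | tri> _ _ x<y | tri< y<z _ _ = ⊥-elim (between (suc (length P) + suc j)
          (m<m+n (suc (length P)) (s≤s z≤n)) (+-monoʳ-< (suc (length P)) (s≤s j<M))
          (subst₂ _<_ (sym (val-block-first P x (M ++ z ∷ S))) (sym valʲ) x<y ,
           subst₂ _<_ (sym valʲ) (sym (val-block-second P x M z S)) y<z))
    where
    valʲ : val U (suc (length P) + suc j) ≡ val M (suc j)
    valʲ = trans (val-block-middle P x M (z ∷ S) j) (val-++ˡ M (z ∷ S) (suc j) j<M)

inv-cover : ∀ {n u k l} → Perm n u → 1 ≤ k → k < l → l ≤ n → val u k < val u l → NoValueBetween u k l →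
  inv (swapPos k l u) ≡ suc (inv u)
inv-cover {u = u} {k} {l} pu 1≤k k<l l≤n uk<ul between
  with blocks u k l 1≤k k<l (subst (l ≤_) (sym (Perm-length pu)) l≤n)
... | P , x , M , z , S , refl , refl , refl =
  trans (cong inv (swapPos-blocks P x M z S))
    (inv-prefix-suc P _ _ (λ y → countBelow-swap-block-ends y x M z S)
      (inv-swap-block-ends x z S M x<z (cover-middle-outside P x M z S (Perm-unique pu) between)))
  where
  x<z : x < z
  x<z = subst₂ _<_ (val-block-first P x (M ++ z ∷ S)) (val-block-second P x M z S) uk<ul

-- The staircase word of w₀

countdown : ℕ → List ℕ
countdown m = map suc (downFrom m)

rowWord : ℕ → ℕ → List ℕ
rowWord k d = map (λ b → k + b ∸ 1) (countdown d)

letter-suc : ∀ k d → k + suc d ∸ 1 ≡ k + d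
letter-suc k d = cong (_∸ 1) (+-suc k d)

rowWord-lowerBound : ∀ k d → All (k ≤_) (rowWord k d)
rowWord-lowerBound k zero = []
rowWord-lowerBound k (suc d) = subst (k ≤_) (sym (letter-suc k d)) (m≤m+n k d) ∷ rowWord-lowerBound k d

rowWord-upperBound : ∀ k d → All (λ a → suc a ≤ k + d) (rowWord k d)
rowWord-upperBound k zero = []
rowWord-upperBound k (suc d) = subst (λ a → suc a ≤ k + suc d) (sym (letter-suc k d)) (≤-reflexive (sym (+-suc k d)))
  ∷ All.map (λ h → ≤-trans h (+-monoʳ-≤ k (n≤1+n d))) (rowWord-upperBound k d)

applyRowWord-start : ∀ k d → applyWord (rowWord k d) k ≡ k + d
applyRowWord-start k zero = sym (+-identityʳ k)
applyRowWord-start k (suc d) = begin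
  tr (k + suc d ∸ 1) (suc (k + suc d ∸ 1)) (applyWord (rowWord k d) k)
    ≡⟨ cong₂ (λ a b → tr a (suc a) b) (letter-suc k d) (applyRowWord-start k d) ⟩
  tr (k + d) (suc (k + d)) (k + d) ≡⟨ tr-left (k + d) (suc (k + d)) ⟩
  suc (k + d) ≡⟨ sym (+-suc k d) ⟩
  k + suc d ∎
  where open ≡-Reasoning

applyRowWord-above : ∀ k d p → k + d < p → applyWord (rowWord k d) p ≡ p
applyRowWord-above k d p h =
  applyWord-fixes-above (rowWord k d) p (All.map (λ a → <-≤-trans (s≤s a) h) (rowWord-upperBound k d))

applyRowWord-below : ∀ k d p → p < k → applyWord (rowWord k d) p ≡ p
applyRowWord-below (suc k) d p (s≤s p≤k) = applyWord-fixes-below k (rowWord (suc k) d) (rowWord-lowerBound (suc k) d) p p≤k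

applyRowWord-shift : ∀ k d p → k ≤ p → p < k + d → applyWord (rowWord k d) (suc p) ≡ p
applyRowWord-shift k zero p kp pd = ⊥-elim (<-irrefl (sym (+-identityʳ k)) (≤-<-trans kp pd))
applyRowWord-shift k (suc d) p kp pd with m≤n⇒m<n∨m≡n (≤-pred (subst (p <_) (+-suc k d) pd))
... | inj₁ lt = begin
    tr (k + suc d ∸ 1) (suc (k + suc d ∸ 1)) (applyWord (rowWord k d) (suc p))
      ≡⟨ cong₂ (λ a b → tr a (suc a) b) (letter-suc k d) (applyRowWord-shift k d p kp lt) ⟩
    tr (k + d) (suc (k + d)) p ≡⟨ tr-other _ _ p (<⇒≢ lt) (<⇒≢ (m<n⇒m<1+n lt)) ⟩
    p ∎
  where open ≡-Reasoning
... | inj₂ refl = begin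
    tr (k + suc d ∸ 1) (suc (k + suc d ∸ 1)) (applyWord (rowWord k d) (suc (k + d)))
      ≡⟨ cong₂ (λ a b → tr a (suc a) b) (letter-suc k d) (applyRowWord-above k d (suc (k + d)) ≤-refl) ⟩
    tr (k + d) (suc (k + d)) (suc (k + d)) ≡⟨ tr-right (k + d) (suc (k + d)) ⟩
    k + d ∎
  where open ≡-Reasoning

range-snoc : ∀ s m → range s (suc m) ≡ range s m ++ [ s + m ]
range-snoc s zero = cong [_] (sym (+-identityʳ s))
range-snoc s (suc m) =
  cong (s ∷_) (trans (range-snoc (suc s) m) (cong (λ t → range (suc s) m ++ [ t ]) (sym (+-suc s m))))

rowsWord : ℕ → ℕ → List ℕ
rowsWord n m = concatMap (λ k → rowWord k (n ∸ k)) (range 1 m)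

applyRowsWord-suc : ∀ n m q →
  applyWord (rowsWord n (suc m)) q ≡ applyWord (rowsWord n m) (applyWord (rowWord (suc m) (n ∸ suc m)) q)
applyRowsWord-suc n m q = trans (cong (λ w → applyWord w q) rowsWord-suc) (applyWord-++ (rowsWord n m) _ q)
  where
  f = λ k → rowWord k (n ∸ k)
  rowsWord-suc : rowsWord n (suc m) ≡ rowsWord n m ++ f (suc m)
  rowsWord-suc = trans (cong (concatMap f) (range-snoc 1 m))
                   (trans (concatMap-++ f (range 1 m) [ suc m ]) (cong (rowsWord n m ++_) (++-identityʳ (f (suc m)))))

applyRowsWord : ∀ n m → m ≤ n → ∀ p → InRange n p →
  (p ≤ m → applyWord (rowsWord n m) p + p ≡ suc n) × (m < p → applyWord (rowsWord n m) p + m ≡ p)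
applyRowsWord n zero _ p (1≤p , _) = (λ p≤0 → ⊥-elim (<-irrefl refl (≤-trans 1≤p p≤0))) , λ _ → +-identityʳ p
applyRowsWord n (suc m) m<n p (1≤p , p≤n) = reversed , shifted
  where
  d = n ∸ suc m
  m+d≡n : suc m + d ≡ n
  m+d≡n = m+[n∸m]≡n m<n
  IH = applyRowsWord n m (≤-trans (n≤1+n m) m<n)
  old = applyWord (rowsWord n m)
  reversed : p ≤ suc m → applyWord (rowsWord n (suc m)) p + p ≡ suc n
  reversed p≤m with m≤n⇒m<n∨m≡n p≤m
  ... | inj₁ p<m = trans (cong (_+ p) (trans (applyRowsWord-suc n m p) (cong old (applyRowWord-below (suc m) d p p<m))))
                         (proj₁ (IH p (1≤p , p≤n)) (≤-pred p<m))
  ... | inj₂ refl = begin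
    applyWord (rowsWord n (suc m)) (suc m) + suc m
      ≡⟨ cong (_+ suc m) (trans (applyRowsWord-suc n m (suc m)) (cong old (trans (applyRowWord-start (suc m) d) m+d≡n))) ⟩
    old n + suc m      ≡⟨ +-suc _ m ⟩
    suc (old n + m)    ≡⟨ cong suc (proj₂ (IH n (≤-trans 1≤p p≤n , ≤-refl)) m<n) ⟩
    suc n              ∎
    where open ≡-Reasoning
  shifted : suc m < p → applyWord (rowsWord n (suc m)) p + suc m ≡ p
  shifted m<p = shifted′ p m<p p≤n
    where
    shifted′ : ∀ p → suc m < p → p ≤ n → applyWord (rowsWord n (suc m)) p + suc m ≡ p
    shifted′ (suc p′) (s≤s m<p′) p≤n′ = begin
      applyWord (rowsWord n (suc m)) (suc p′) + suc m
        ≡⟨ cong (_+ suc m) (trans (applyRowsWord-suc n m (suc p′))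
             (cong old (applyRowWord-shift (suc m) d p′ m<p′ (subst (p′ <_) (sym m+d≡n) p≤n′)))) ⟩
      old p′ + suc m     ≡⟨ +-suc _ m ⟩
      suc (old p′ + m)
        ≡⟨ cong suc (proj₂ (IH p′ (≤-trans (s≤s z≤n) m<p′ , ≤-trans (n≤1+n p′) p≤n′)) m<p′) ⟩
      suc p′             ∎
      where open ≡-Reasoning

-- P_n and the complement of a set of labels

row : ℕ → ℕ → List (ℕ × ℕ)
row n k = map (λ b → (k , b)) (countdown (n ∸ k))

orderedPn≡rows : ∀ n → orderedPn n ≡ concatMap (row n) (range 1 n)
orderedPn≡rows n = cong (concatMap (row n)) (idPerm≡range n)

range-split : ∀ s a c → range s (a + suc c) ≡ range s a ++ (s + a) ∷ range (suc (s + a)) c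
range-split s zero c = cong (λ t → t ∷ range (suc t) c) (sym (+-identityʳ s))
range-split s (suc a) c = cong (s ∷_) (trans (range-split (suc s) a c)
  (cong (λ t → range (suc s) a ++ t ∷ range (suc t) c) (sym (+-suc s a))))

range-bounds : ∀ s m' → All (λ k → s ≤ k × k < s + m') (range s m')
range-bounds s zero = []
range-bounds s (suc m') = (≤-refl , subst (s <_) (sym (+-suc s m')) (s≤s (m≤m+n s m')))
  ∷ All.map (λ {x} (a , b) → ≤-trans (n≤1+n s) a , subst (x <_) (sym (+-suc s m')) b) (range-bounds (suc s) m')

countdown-split : ∀ t b → countdown (t + b) ≡ map (_+ b) (countdown t) ++ countdown b
countdown-split zero b = refl
countdown-split (suc t) b = cong (suc (t + b) ∷_) (countdown-split t b)

countdown-bounds : ∀ d → All (λ x → 1 ≤ x × x ≤ d) (countdown d)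
countdown-bounds zero = []
countdown-bounds (suc d) = (s≤s z≤n , ≤-refl) ∷ All.map (λ (a , b) → a , m≤n⇒m≤1+n b) (countdown-bounds d)

All-concatMap : ∀ {A B : Set} {Q : A → Set} {P : B → Set} (R : A → List B) ks →
  All Q ks → (∀ k → Q k → All P (R k)) → All P (concatMap R ks)
All-concatMap R [] [] h = []
All-concatMap R (k ∷ ks) (q ∷ qs) h = AllP.++⁺ (h k q) (All-concatMap R ks qs h)

row-elements : ∀ n k → All (λ x → proj₁ x ≡ k × 1 ≤ proj₂ x × proj₂ x ≤ n ∸ k) (row n k)
row-elements n k = AllP.map⁺ (All.map (λ (a , b) → refl , a , b) (countdown-bounds (n ∸ k)))

InPn : ℕ → ℕ × ℕ → Set
InPn n (k , b) = 1 ≤ k × 1 ≤ b × k + b ≤ n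

+-≤-of-≤∸ : ∀ n k x → 1 ≤ x → x ≤ n ∸ k → k + x ≤ n
+-≤-of-≤∸ n k x x1 xn = ≤-trans (+-monoʳ-≤ k xn) (≤-reflexive (m+[n∸m]≡n kn))
  where
  kn : k ≤ n
  kn = <⇒≤ (m∸n≢0⇒n<m (λ e → <-irrefl refl (≤-trans x1 (subst (x ≤_) e xn)) ))

orderedPn-InPn : ∀ n → All (InPn n) (orderedPn n)
orderedPn-InPn n = subst (All (InPn n)) (sym (orderedPn≡rows n))
  (All-concatMap (row n) (range 1 n) (range-bounds 1 n) λ k (1≤k , _) →
     All.map (λ { {k′ , x} (refl , 1≤x , x≤) → 1≤k , 1≤x , +-≤-of-≤∸ n k′ x 1≤x x≤ }) (row-elements n k))

letter : ℕ × ℕ → ℕ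
letter (k , b) = k + b ∸ 1

letter-valid : ∀ n x → InPn n x → ValidLetter n (letter x)
letter-valid n (suc k , suc b) (_ , _ , le) = subst (1 ≤_) (sym (+-suc k b)) (s≤s z≤n) , le

dWord≡map-letter : ∀ xs → dWord xs ≡ map letter xs
dWord≡map-letter [] = refl
dWord≡map-letter ((k , b) ∷ xs) = cong (_ ∷_) (dWord≡map-letter xs)

complement-letters-valid : ∀ n L → All (ValidLetter n) (dWord (complementIn n L))
complement-letters-valid n L = subst (All (ValidLetter n)) (sym (dWord≡map-letter (complementIn n L)))
  (AllP.map⁺ (AllP.filter⁺ (λ p → ¬? (p ∈ₚ? L)) (All.map (λ {x} h → letter-valid n x h) (orderedPn-InPn n))))

filter-cong : ∀ {A : Set} {P Q : A → Set} (P? : Decidable P) (Q? : Decidable Q) xs →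
  All (λ x → (P x → Q x) × (Q x → P x)) xs → filter P? xs ≡ filter Q? xs
filter-cong P? Q? [] [] = refl
filter-cong {P = P} P? Q? (x ∷ xs) ((pq , qp) ∷ hs) = go (P? x)
  where
  go : Dec (P x) → filter P? (x ∷ xs) ≡ filter Q? (x ∷ xs)
  go (yes px) = trans (filter-accept P? px)
    (sym (trans (filter-accept Q? (pq px)) (cong (x ∷_) (sym (filter-cong P? Q? xs hs)))))
  go (no npx) = trans (filter-reject P? npx)
    (sym (trans (filter-reject Q? (npx ∘ qp)) (sym (filter-cong P? Q? xs hs))))

module SplitAtLabel (n m e : ℕ) (k+b≤n : suc m + suc e ≤ n) where
  k₁ : ℕ
  k₁ = suc m
  b₁ : ℕ
  b₁ = suc e
  rowLen : ℕ
  rowLen = n ∸ k₁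
  aboveLen : ℕ
  aboveLen = rowLen ∸ b₁
  k₁≤n : k₁ ≤ n
  k₁≤n = ≤-trans (m≤m+n k₁ b₁) k+b≤n
  b₁≤rowLen : b₁ ≤ rowLen
  b₁≤rowLen = m+n≤o⇒m≤o∸n b₁ (subst (_≤ n) (+-comm k₁ b₁) k+b≤n)
  rows-length : m + suc rowLen ≡ n
  rows-length = trans (+-suc m rowLen) (m+[n∸m]≡n k₁≤n)
  row-length : aboveLen + b₁ ≡ rowLen
  row-length = m∸n+n≡m b₁≤rowLen
  rowsBefore : List (ℕ × ℕ)
  rowsBefore = concatMap (row n) (range 1 m)
  rowsAfter : List (ℕ × ℕ)
  rowsAfter = concatMap (row n) (range (suc k₁) rowLen)
  rowAbove : List (ℕ × ℕ)
  rowAbove = map (λ b → (k₁ , b)) (map (_+ b₁) (countdown aboveLen))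
  rowBelow : List (ℕ × ℕ)
  rowBelow = map (λ b → (k₁ , b)) (countdown e)

  row-split : row n k₁ ≡ rowAbove ++ (k₁ , b₁) ∷ rowBelow
  row-split = trans (cong (map (λ b → (k₁ , b))) (trans (cong countdown (sym row-length)) (countdown-split aboveLen b₁)))
               (map-++ (λ b → (k₁ , b)) (map (_+ b₁) (countdown aboveLen)) (countdown b₁))

  orderedPn-split : orderedPn n ≡ rowsBefore ++ ((rowAbove ++ (k₁ , b₁) ∷ rowBelow) ++ rowsAfter)
  orderedPn-split = begin
    orderedPn n ≡⟨ orderedPn≡rows n ⟩
    concatMap (row n) (range 1 n)
      ≡⟨ cong (concatMap (row n)) (trans (cong (range 1) (sym rows-length)) (range-split 1 m rowLen)) ⟩
    concatMap (row n) (range 1 m ++ k₁ ∷ range (suc k₁) rowLen) ≡⟨ concatMap-++ (row n) (range 1 m) _ ⟩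
    rowsBefore ++ (row n k₁ ++ rowsAfter) ≡⟨ cong (λ z → rowsBefore ++ (z ++ rowsAfter)) row-split ⟩
    rowsBefore ++ ((rowAbove ++ (k₁ , b₁) ∷ rowBelow) ++ rowsAfter) ∎
    where open ≡-Reasoning

  rowsBefore-fst : All (λ x → proj₁ x < k₁) rowsBefore
  rowsBefore-fst = All-concatMap (row n) (range 1 m) (range-bounds 1 m) λ k (_ , kb) →
    All.map (λ { (refl , _) → kb }) (row-elements n k)

  rowsAfter-fst : All (λ x → k₁ < proj₁ x) rowsAfter
  rowsAfter-fst = All-concatMap (row n) (range (suc k₁) rowLen) (range-bounds (suc k₁) rowLen) λ k (kb , _) →
    All.map (λ { (refl , _) → kb }) (row-elements n k)

  rowsAfter-snd : All (λ x → 1 ≤ proj₂ x) rowsAfter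
  rowsAfter-snd = All-concatMap (row n) (range (suc k₁) rowLen) (range-bounds (suc k₁) rowLen) λ k _ →
    All.map (λ (_ , a , _) → a) (row-elements n k)

  rowAbove-elements : All (λ x → proj₁ x ≡ k₁ × b₁ < proj₂ x) rowAbove
  rowAbove-elements = AllP.map⁺ (AllP.map⁺ (All.map (λ (a , _) → refl , +-monoˡ-≤ b₁ a) (countdown-bounds aboveLen)))

  rowBelow-elements : All (λ x → proj₁ x ≡ k₁ × proj₂ x < b₁) rowBelow
  rowBelow-elements = AllP.map⁺ (All.map (λ (_ , b) → refl , s≤s b) (countdown-bounds e))

letters-row : ∀ n k → map letter (row n k) ≡ rowWord k (n ∸ k)
letters-row n k = sym (map-∘ (countdown (n ∸ k)))

letters-rows : ∀ n m → map letter (concatMap (row n) (range 1 m)) ≡ rowsWord n m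
letters-rows n m = trans (map-concatMap letter (row n) (range 1 m)) (concatMap-cong (letters-row n) (range 1 m))

filter-around : ∀ {A : Set} {P : A → Set} (P? : Decidable P) B X (x : A) Y C → All P B →
  filter P? (B ++ ((X ++ x ∷ Y) ++ C)) ≡ B ++ ((filter P? X ++ filter P? (x ∷ Y)) ++ filter P? C)
filter-around P? B X x Y C pB = begin
  filter P? (B ++ ((X ++ x ∷ Y) ++ C))
    ≡⟨ filter-++ P? B _ ⟩
  filter P? B ++ filter P? ((X ++ x ∷ Y) ++ C)
    ≡⟨ cong₂ _++_ (filter-all P? pB) (filter-++ P? (X ++ x ∷ Y) C) ⟩
  B ++ (filter P? (X ++ x ∷ Y) ++ filter P? C)
    ≡⟨ cong (λ z → B ++ (z ++ filter P? C)) (filter-++ P? X (x ∷ Y)) ⟩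
  B ++ ((filter P? X ++ filter P? (x ∷ Y)) ++ filter P? C) ∎
  where open ≡-Reasoning

map-around : ∀ {A B : Set} (f : A → B) P X x Y C →
  map f (P ++ ((X ++ x ∷ Y) ++ C)) ≡ (map f P ++ map f X) ++ f x ∷ (map f Y ++ map f C)
map-around f [] [] x Y C = cong (f x ∷_) (map-++ f Y C)
map-around f [] (y ∷ X) x Y C = cong (f y ∷_) (map-around f [] X x Y C)
map-around f (p ∷ P) X x Y C = cong (f p ∷_) (map-around f P X x Y C)

map-around′ : ∀ {A B : Set} (f : A → B) P X Y C →
  map f (P ++ ((X ++ Y) ++ C)) ≡ (map f P ++ map f X) ++ (map f Y ++ map f C)
map-around′ f [] [] Y C = map-++ f Y C
map-around′ f [] (y ∷ X) Y C = cong (f y ∷_) (map-around′ f [] X Y C)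
map-around′ f (p ∷ P) X Y C = cong (f p ∷_) (map-around′ f P X Y C)

-- The labels L of the rest of an increasing chain all come after (k₁, b₁), so the complement of L
-- contains every cell of P_n before (k₁, b₁): its word starts with the staircase up to (k₁, b₁).
module ComplementAtLabel (n m e : ℕ) (k+b≤n : suc m + suc e ≤ n) (L : List (ℕ × ℕ))
            (after-label : All ((suc m , suc e) <ₗ_) L) where
  open SplitAtLabel n m e k+b≤n

  ∉L? : Decidable (λ p → ¬ (p ∈ L))
  ∉L? p = ¬? (p ∈ₚ? L)

  ∉label∷L? : Decidable (λ p → ¬ (p ∈ (k₁ , b₁) ∷ L))
  ∉label∷L? p = ¬? (p ∈ₚ? ((k₁ , b₁) ∷ L))

  ∉L-before : ∀ x → proj₁ x < k₁ → ¬ (x ∈ L)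
  ∉L-before (a , b) a<k₁ x∈L with All.lookup after-label x∈L
  ... | fst< k₁<a = <-asym a<k₁ k₁<a
  ... | snd< _ = <-irrefl refl a<k₁

  ∉L-below : ∀ x → proj₁ x ≡ k₁ → proj₂ x ≤ b₁ → ¬ (x ∈ L)
  ∉L-below (a , b) refl b≤b₁ x∈L with All.lookup after-label x∈L
  ... | fst< k₁<k₁ = <-irrefl refl k₁<k₁
  ... | snd< b₁<b = <-irrefl refl (<-≤-trans b₁<b b≤b₁)

  ∉∷⇔∉ : ∀ x → x ≢ (k₁ , b₁) →
    (¬ (x ∈ (k₁ , b₁) ∷ L) → ¬ (x ∈ L)) × (¬ (x ∈ L) → ¬ (x ∈ (k₁ , b₁) ∷ L))
  ∉∷⇔∉ x x≢ = (λ h q → h (there q)) , λ h → λ { (here q) → x≢ q ; (there q) → h q }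

  ≢-fst : ∀ {x : ℕ × ℕ} → proj₁ x ≢ k₁ → x ≢ (k₁ , b₁)
  ≢-fst a≢k₁ refl = a≢k₁ refl

  ≢-snd : ∀ {x : ℕ × ℕ} → proj₂ x ≢ b₁ → x ≢ (k₁ , b₁)
  ≢-snd b≢b₁ refl = b≢b₁ refl

  rowsBefore-∉L : All (λ x → ¬ (x ∈ L)) rowsBefore
  rowsBefore-∉L = All.map (λ {x} → ∉L-before x) rowsBefore-fst

  rowBelow-∉L : All (λ x → ¬ (x ∈ L)) rowBelow
  rowBelow-∉L = All.map (λ {x} (a , b) → ∉L-below x a (<⇒≤ b)) rowBelow-elements

  complement-split : complementIn n L ≡
    rowsBefore ++ ((filter ∉L? rowAbove ++ (k₁ , b₁) ∷ rowBelow) ++ filter ∉L? rowsAfter)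
  complement-split = begin
    filter ∉L? (orderedPn n)
      ≡⟨ cong (filter ∉L?) orderedPn-split ⟩
    filter ∉L? (rowsBefore ++ ((rowAbove ++ (k₁ , b₁) ∷ rowBelow) ++ rowsAfter))
      ≡⟨ filter-around ∉L? rowsBefore rowAbove (k₁ , b₁) rowBelow rowsAfter rowsBefore-∉L ⟩
    rowsBefore ++ ((filter ∉L? rowAbove ++ filter ∉L? ((k₁ , b₁) ∷ rowBelow)) ++ filter ∉L? rowsAfter)
      ≡⟨ cong (λ z → rowsBefore ++ ((filter ∉L? rowAbove ++ z) ++ filter ∉L? rowsAfter)) label-kept ⟩
    rowsBefore ++ ((filter ∉L? rowAbove ++ (k₁ , b₁) ∷ rowBelow) ++ filter ∉L? rowsAfter) ∎
    where
    open ≡-Reasoning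
    label-kept : filter ∉L? ((k₁ , b₁) ∷ rowBelow) ≡ (k₁ , b₁) ∷ rowBelow
    label-kept = trans (filter-accept ∉L? (∉L-below (k₁ , b₁) refl ≤-refl))
                       (cong ((k₁ , b₁) ∷_) (filter-all ∉L? rowBelow-∉L))

  complement-cons-split : complementIn n ((k₁ , b₁) ∷ L) ≡
    rowsBefore ++ ((filter ∉L? rowAbove ++ rowBelow) ++ filter ∉L? rowsAfter)
  complement-cons-split = begin
    filter ∉label∷L? (orderedPn n)
      ≡⟨ cong (filter ∉label∷L?) orderedPn-split ⟩
    filter ∉label∷L? (rowsBefore ++ ((rowAbove ++ (k₁ , b₁) ∷ rowBelow) ++ rowsAfter))
      ≡⟨ filter-around ∉label∷L? rowsBefore rowAbove (k₁ , b₁) rowBelow rowsAfter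
           (All.map (λ {x} lt → proj₂ (∉∷⇔∉ x (≢-fst (<⇒≢ lt))) (∉L-before x lt)) rowsBefore-fst) ⟩
    rowsBefore ++ ((filter ∉label∷L? rowAbove ++ label-dropped) ++ filter ∉label∷L? rowsAfter)
      ≡⟨ cong₂ (λ y z → rowsBefore ++ ((y ++ label-dropped) ++ z)) above-same after-same ⟩
    rowsBefore ++ ((filter ∉L? rowAbove ++ filter ∉label∷L? ((k₁ , b₁) ∷ rowBelow)) ++ filter ∉L? rowsAfter)
      ≡⟨ cong (λ z → rowsBefore ++ ((filter ∉L? rowAbove ++ z) ++ filter ∉L? rowsAfter)) label-dropped≡ ⟩
    rowsBefore ++ ((filter ∉L? rowAbove ++ rowBelow) ++ filter ∉L? rowsAfter) ∎
    where
    open ≡-Reasoning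
    label-dropped = filter ∉label∷L? ((k₁ , b₁) ∷ rowBelow)
    label-dropped≡ : label-dropped ≡ rowBelow
    label-dropped≡ = trans (filter-reject ∉label∷L? (λ h → h (here refl)))
      (filter-all ∉label∷L?
        (All.map (λ {x} (a , b) → proj₂ (∉∷⇔∉ x (≢-snd (<⇒≢ b))) (∉L-below x a (<⇒≤ b)))
                                     rowBelow-elements))
    above-same : filter ∉label∷L? rowAbove ≡ filter ∉L? rowAbove
    above-same = filter-cong ∉label∷L? ∉L? rowAbove
      (All.map (λ {x} (_ , b) → ∉∷⇔∉ x (≢-snd (λ q → <-irrefl (sym q) b))) rowAbove-elements)
    after-same : filter ∉label∷L? rowsAfter ≡ filter ∉L? rowsAfter
    after-same = filter-cong ∉label∷L? ∉L? rowsAfter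
      (All.map (λ {x} lt → ∉∷⇔∉ x (≢-fst (λ q → <-irrefl (sym q) lt))) rowsAfter-fst)

  c : ℕ
  c = m + b₁

  wordBefore : List ℕ
  wordBefore = map letter rowsBefore ++ map letter (filter ∉L? rowAbove)

  wordAfter : List ℕ
  wordAfter = map letter rowBelow ++ map letter (filter ∉L? rowsAfter)

  word-split : dWord (complementIn n L) ≡ wordBefore ++ c ∷ wordAfter
  word-split = trans (dWord≡map-letter _) (trans (cong (map letter) complement-split)
    (map-around letter rowsBefore (filter ∉L? rowAbove) (k₁ , b₁) rowBelow (filter ∉L? rowsAfter)))

  word-cons-split : dWord (complementIn n ((k₁ , b₁) ∷ L)) ≡ wordBefore ++ wordAfter
  word-cons-split = trans (dWord≡map-letter _) (trans (cong (map letter) complement-cons-split)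
    (map-around′ letter rowsBefore (filter ∉L? rowAbove) rowBelow (filter ∉L? rowsAfter)))

  -- The first m rows send c = m + b₁ > m down to b₁; the letters of row k₁ above b₁ are larger than c.
  wordBefore-c : applyWord wordBefore c ≡ b₁
  wordBefore-c = begin
    applyWord wordBefore c
      ≡⟨ applyWord-++ (map letter rowsBefore) _ c ⟩
    applyWord (map letter rowsBefore) (applyWord (map letter (filter ∉L? rowAbove)) c)
      ≡⟨ cong (applyWord (map letter rowsBefore)) (applyWord-fixes-below c _ above-c c ≤-refl) ⟩
    applyWord (map letter rowsBefore) c
      ≡⟨ cong (λ l → applyWord l c) (letters-rows n m) ⟩
    applyWord (rowsWord n m) c
      ≡⟨ +-cancelˡ-≡ m _ _ (trans (+-comm m _) (proj₂ (applyRowsWord n m m≤n c c-InRange) m<c)) ⟩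
    b₁ ∎
    where
    open ≡-Reasoning
    m≤n : m ≤ n
    m≤n = ≤-trans (n≤1+n m) k₁≤n
    m<c : m < c
    m<c = m<m+n m (s≤s z≤n)
    c-InRange : InRange n c
    c-InRange = ≤-trans (s≤s z≤n) m<c , ≤-trans (n≤1+n c) k+b≤n
    above-c : All (c <_) (map letter (filter ∉L? rowAbove))
    above-c = AllP.map⁺ (AllP.filter⁺ ∉L? (All.map (λ { {(k , y)} (refl , lt) → +-monoʳ-< m lt }) rowAbove-elements))

  wordAfter-k₁ : applyWord wordAfter k₁ ≡ c
  wordAfter-k₁ = begin
    applyWord wordAfter k₁
      ≡⟨ applyWord-++ (map letter rowBelow) _ k₁ ⟩
    applyWord (map letter rowBelow) (applyWord (map letter (filter ∉L? rowsAfter)) k₁)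
      ≡⟨ cong (applyWord (map letter rowBelow)) (applyWord-fixes-below k₁ _ after-k₁ k₁ ≤-refl) ⟩
    applyWord (map letter rowBelow) k₁
      ≡⟨ cong (λ l → applyWord l k₁) (sym (map-∘ (countdown e))) ⟩
    applyWord (rowWord k₁ e) k₁
      ≡⟨ applyRowWord-start k₁ e ⟩
    k₁ + e
      ≡⟨ sym (+-suc m e) ⟩
    c ∎
    where
    open ≡-Reasoning
    letter-after : ∀ x → k₁ < proj₁ x → 1 ≤ proj₂ x → k₁ < letter x
    letter-after (suc k , suc y) lt _ = ≤-trans lt (≤-trans (m≤m+n (suc k) y) (≤-reflexive (sym (+-suc k y))))
    after-k₁ : All (k₁ <_) (map letter (filter ∉L? rowsAfter))
    after-k₁ = AllP.map⁺ (AllP.filter⁺ ∉L?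
      (All.zipWith (λ {x} (lt , 1≤b) → letter-after x lt 1≤b) (rowsAfter-fst , rowsAfter-snd)))

triangle : ℕ → ℕ
triangle zero = 0
triangle (suc n) = n + triangle n

length-countdown : ∀ n → length (countdown n) ≡ n
length-countdown n = trans (length-map suc (downFrom n)) (length-downFrom n)

inv-w₀-triangle : ∀ n → inv (w₀ n) ≡ triangle n
inv-w₀-triangle zero = refl
inv-w₀-triangle (suc n) = cong₂ _+_
  (trans (cong length (filter-all (_<? suc n) (All.map (λ (_ , b) → s≤s b) (countdown-bounds n)))) (length-countdown n))
  (inv-w₀-triangle n)

length-row : ∀ N k → length (row N k) ≡ N ∸ k
length-row N k = trans (length-map _ (countdown (N ∸ k))) (length-countdown (N ∸ k))

length-rows : ∀ s m → length (concatMap (row (s + m)) (range (suc s) m)) ≡ triangle m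
length-rows s zero = refl
length-rows s (suc m) = trans (length-++ (row (s + suc m) (suc s)))
  (cong₂ _+_ (trans (length-row (s + suc m) (suc s)) (trans (cong (_∸ suc s) (+-suc s m)) (m+n∸m≡n s m)))
     (trans (cong (λ N → length (concatMap (row N) (range (suc (suc s)) m))) (+-suc s m)) (length-rows (suc s) m)))

inv-w₀ : ∀ n → inv (w₀ n) ≡ length (orderedPn n)
inv-w₀ n = trans (inv-w₀-triangle n) (sym (trans (cong length (orderedPn≡rows n)) (length-rows 0 n)))

val-w₀ : ∀ n p → 1 ≤ p → p ≤ n → val (w₀ n) p + p ≡ suc n
val-w₀ (suc n) (suc zero) _ _ = +-comm (suc n) 1
val-w₀ (suc n) (suc (suc p)) _ (s≤s le) =
  trans (+-suc (val (w₀ n) (suc p)) (suc p)) (cong suc (val-w₀ n (suc p) (s≤s z≤n) le))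

complementIn-[] : ∀ n → complementIn n [] ≡ orderedPn n
complementIn-[] n = filter-all (λ p → ¬? (p ∈ₚ? [])) (All.tabulate (λ _ ()))

complementWord-[] : ∀ n → dWord (complementIn n []) ≡ rowsWord n n
complementWord-[] n = trans (dWord≡map-letter _)
  (trans (cong (map letter) (trans (complementIn-[] n) (orderedPn≡rows n))) (letters-rows n n))

-- The invariant along an increasing chain

-- u agrees with w₀ = n⋯21 at position p.
SettledAt : ℕ → List ℕ → ℕ → Set
SettledAt n u p = val u p + p ≡ suc n

SettledBelow : ℕ → List ℕ → ℕ → Set
SettledBelow n u k = ∀ p → 1 ≤ p → p < k → p ≤ n → SettledAt n u p

LabelInvariant : ℕ → List ℕ → ℕ → ℕ → Set
LabelInvariant n u k b = SettledBelow n u k × (1 ≤ k → k ≤ n → b < val u k ⊎ SettledAt n u k)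

SettledBelow-mono : ∀ {n u k k′} → k ≤ k′ → SettledBelow n u k′ → SettledBelow n u k
SettledBelow-mono k≤k′ s p 1≤p p<k = s p 1≤p (<-≤-trans p<k k≤k′)

module SettledSwap {n : ℕ} {u v : List ℕ} {i j : ℕ} (pu : PermVals n u) (ev : v ≡ swapPos i j u) where
  open SwapVals pu ev

  SettledAt-swap-other : ∀ p → InRange n p → p ≢ i → p ≢ j → SettledAt n v p → SettledAt n u p
  SettledAt-swap-other p r a b s = trans (cong (_+ p) (sym (val-swap-other p r a b))) s

  SettledBelow-swap : ∀ {k} → k ≤ i → i < j → SettledBelow n v k → SettledBelow n u k
  SettledBelow-swap k≤i i<j s p 1≤p p<k p≤n =
    SettledAt-swap-other p (1≤p , p≤n) (<⇒≢ p<i) (<⇒≢ (<-trans p<i i<j)) (s p 1≤p p<k p≤n)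
    where
    p<i = <-≤-trans p<k k≤i

+-bounded-by-avoidance : ∀ n x k → x ≤ n → (∀ p → 1 ≤ p → p < k → x + p ≢ suc n) → x + k ≤ suc n
+-bounded-by-avoidance n x zero xn h = ≤-trans (≤-reflexive (+-identityʳ x)) (m≤n⇒m≤1+n xn)
+-bounded-by-avoidance n x (suc zero) xn h = ≤-trans (≤-reflexive (+-comm x 1)) (s≤s xn)
+-bounded-by-avoidance n x (suc (suc k)) xn h =
  let ih = +-bounded-by-avoidance n x (suc k) xn (λ p p1 pk → h p p1 (m<n⇒m<1+n pk))
      ne = h (suc k) (s≤s z≤n) ≤-refl
  in ≤-trans (≤-reflexive (+-suc x (suc k))) (≤∧≢⇒< ih ne)

-- The values n+1-p at settled positions p < k are taken, so any other value is at most n+1-k.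
val-bounded-when-settled : ∀ {n u k q} → PermVals n u → SettledBelow n u k → InRange n q → k ≤ q →
  val u q + k ≤ suc n
val-bounded-when-settled {n} {u} {k} {q} pu s rq@(_ , q≤n) k≤q =
  +-bounded-by-avoidance n (val u q) k (proj₂ (val-InRange q rq)) λ p 1≤p p<k eq →
    val-injective q p rq (1≤p , p≤n p<k) (λ q≡p → <-irrefl (sym q≡p) (<-≤-trans p<k k≤q))
      (+-cancelʳ-≡ p _ _ (trans eq (sym (s p 1≤p p<k (p≤n p<k)))))
  where
  open PermVals pu
  p≤n : ∀ {p} → p < k → p ≤ n
  p≤n p<k = ≤-trans (<⇒≤ (<-≤-trans p<k k≤q)) q≤n

between-pred : ∀ {x y z} → x < z → z ≡ suc y → x ≢ y → x < y × y < z
between-pred {x} {y} x<z refl x≢y = ≤∧≢⇒< (≤-pred x<z) x≢y , ≤-refl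

-- If i < k₁, then i is settled in v, which pins u(j) = n+1-i; the next position towards k₁
-- then carries a value strictly between u(i) and u(j), contradicting the cover.
edge-starts-at-label : ∀ {n u v i j k₁ b₁} → PermVals n u → v ≡ swapPos i j u → 1 ≤ i → i < j → j ≤ n →
  val u i < val u j → NoValueBetween u i j → i ≤ k₁ → k₁ < j → LabelInvariant n v k₁ b₁ → b₁ ≡ val u i →
  i ≡ k₁
edge-starts-at-label {n} {u} {v} {i} {j} {k₁} {b₁} pu ev 1≤i i<j j≤n ui<uj between i≤k₁ k₁<j (sv , atk₁) b₁≡ui
  with i ≟ k₁
... | yes i≡k₁ = i≡k₁
... | no i≢k₁ = ⊥-elim (contradiction (≤∧≢⇒< i≤k₁ i≢k₁))
  where
  open PermVals pu
  open SwapVals pu ev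
  open SettledSwap pu ev
  ri : InRange n i
  ri = 1≤i , ≤-trans (<⇒≤ i<j) j≤n
  rj : InRange n j
  rj = ≤-trans 1≤i (<⇒≤ i<j) , j≤n
  rk₁ : InRange n k₁
  rk₁ = ≤-trans 1≤i i≤k₁ , ≤-trans (<⇒≤ k₁<j) j≤n
  uj+i : val u j + i ≡ suc n
  uj+i = trans (cong (_+ i) (sym (val-swap-i ri))) (sv i 1≤i (≤∧≢⇒< i≤k₁ i≢k₁) (proj₂ ri))
  uj≡suc : ∀ q → SettledAt n u q → q ≡ suc i → val u j ≡ suc (val u q)
  uj≡suc q s refl = +-cancelʳ-≡ i _ _ (trans uj+i (trans (sym s) (+-suc (val u q) i)))
  contradiction : i < k₁ → ⊥
  contradiction i<k₁ with m≤n⇒m<n∨m≡n i<k₁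
  ... | inj₁ si<k₁ = between (suc i) ≤-refl (<-trans si<k₁ k₁<j)
          (between-pred ui<uj (uj≡suc (suc i) settled refl) (val-injective i (suc i) ri rs (<⇒≢ ≤-refl)))
    where
    rs : InRange n (suc i)
    rs = s≤s z≤n , ≤-trans (<⇒≤ si<k₁) (proj₂ rk₁)
    settled : SettledAt n u (suc i)
    settled = SettledAt-swap-other (suc i) rs (λ q → <-irrefl (sym q) ≤-refl) (<⇒≢ (<-trans si<k₁ k₁<j))
                (sv (suc i) (s≤s z≤n) si<k₁ (proj₂ rs))
  ... | inj₂ refl = between k₁ i<k₁ k₁<j (ui<uk₁ (atk₁ (proj₁ rk₁) (proj₂ rk₁)) , uk₁<uj)
    where
    uk₁≡vk₁ : val v k₁ ≡ val u k₁
    uk₁≡vk₁ = val-swap-other k₁ rk₁ (i≢k₁ ∘ sym) (<⇒≢ k₁<j)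
    u-settled : SettledBelow n u i
    u-settled = SettledBelow-swap ≤-refl i<j (SettledBelow-mono {u = v} (n≤1+n i) sv)
    uk₁<uj : val u k₁ < val u j
    uk₁<uj = +-cancelʳ-< i _ _ (subst (val u k₁ + i <_) (sym uj+i)
      (≤∧≢⇒< (val-bounded-when-settled pu u-settled rk₁ i≤k₁)
             (λ eq → val-injective k₁ j rk₁ rj (<⇒≢ k₁<j) (+-cancelʳ-≡ i _ _ (trans eq (sym uj+i))))))
    ui<uk₁ : b₁ < val v k₁ ⊎ SettledAt n v k₁ → val u i < val u k₁
    ui<uk₁ (inj₁ b₁<vk₁) = subst₂ _<_ b₁≡ui uk₁≡vk₁ b₁<vk₁
    ui<uk₁ (inj₂ s) = proj₁ (between-pred ui<uj
      (uj≡suc k₁ (SettledAt-swap-other k₁ rk₁ (i≢k₁ ∘ sym) (<⇒≢ k₁<j) s) refl)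
      (val-injective i k₁ ri rk₁ i≢k₁))

LabelInvariant-backward : ∀ {n u v k₁ j b₁ k b} → PermVals n u → v ≡ swapPos k₁ j u →
  1 ≤ k₁ → k₁ < j → j ≤ n →
  LabelInvariant n v k₁ b₁ → b₁ ≡ val u k₁ → (k , b) <ₗ (k₁ , b₁) → LabelInvariant n u k b
LabelInvariant-backward {n} {u} {v} {k₁} {j} {b₁} {k} {b} pu ev _ k₁<j _ (sv , _) b₁≡uk₁ lab =
  SettledBelow-swap (k≤k₁ lab) k₁<j (SettledBelow-mono {u = v} (k≤k₁ lab) sv) , atk lab
  where
  open SettledSwap pu ev
  k≤k₁ : (k , b) <ₗ (k₁ , b₁) → k ≤ k₁
  k≤k₁ (fst< k<k₁) = <⇒≤ k<k₁
  k≤k₁ (snd< _) = ≤-refl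
  atk : (k , b) <ₗ (k₁ , b₁) → 1 ≤ k → k ≤ n → b < val u k ⊎ SettledAt n u k
  atk (fst< k<k₁) 1≤k k≤n =
    inj₂ (SettledAt-swap-other k (1≤k , k≤n) (<⇒≢ k<k₁) (<⇒≢ (<-trans k<k₁ k₁<j)) (sv k 1≤k k<k₁ k≤n))
  atk (snd< b<b₁) _ _ = inj₁ (subst (b <_) b₁≡uk₁ b<b₁)

label-in-staircase : ∀ {n v k₁ b₁} → PermVals n v → SettledBelow n v k₁ → 1 ≤ k₁ → k₁ ≤ n →
  b₁ < val v k₁ →
  k₁ + b₁ ≤ n
label-in-staircase {n} {v} {k₁} {b₁} pv sv 1≤k₁ k₁≤n b₁<vk₁ =
  ≤-pred (subst (_< suc n) (+-comm b₁ k₁)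
    (<-≤-trans (+-monoˡ-< k₁ b₁<vk₁) (val-bounded-when-settled pv sv (1≤k₁ , k₁≤n) ≤-refl)))

-- Increasing chains

<ₗ-trans : ∀ {x y z} → x <ₗ y → y <ₗ z → x <ₗ z
<ₗ-trans (fst< a) (fst< b) = fst< (<-trans a b)
<ₗ-trans (fst< a) (snd< b) = fst< a
<ₗ-trans (snd< a) (fst< b) = fst< b
<ₗ-trans (snd< a) (snd< b) = snd< (<-trans a b)

Linked⇒All : ∀ {x xs} → Linked _<ₗ_ (x ∷ xs) → All (x <ₗ_) xs
Linked⇒All [-] = []
Linked⇒All (r ∷ l) = r ∷ All.map (<ₗ-trans r) (Linked⇒All l)

tr-conjugate : ∀ w k₁ j c i → k₁ ≢ j → applyWord w k₁ ≡ c → applyWord w j ≡ suc c →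
  tr c (suc c) (applyWord w (tr k₁ j i)) ≡ applyWord w i
tr-conjugate w k₁ j c i k₁≢j wk₁ wj with i ≟ k₁ | i ≟ j
... | yes refl | _ =
  trans (cong (λ t → tr c (suc c) (applyWord w t)) (tr-left i j))
        (trans (cong (tr c (suc c)) wj) (trans (tr-right c (suc c)) (sym wk₁)))
... | no _ | yes refl =
  trans (cong (λ t → tr c (suc c) (applyWord w t)) (tr-right k₁ i))
        (trans (cong (tr c (suc c)) wk₁) (trans (tr-left c (suc c)) (sym wj)))
... | no i≢k₁ | no i≢j =
  trans (cong (λ t → tr c (suc c) (applyWord w t)) (tr-other k₁ j i i≢k₁ i≢j))
        (tr-other c (suc c) (applyWord w i) (i≢k₁ ∘ applyWord-injective w ∘ flip trans (sym wk₁))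
                                           (i≢j ∘ applyWord-injective w ∘ flip trans (sym wj)))

EdgesAtLabel : List Step → Set
EdgesAtLabel γ = ∀ u k b v → (u , (k , b) , v) ∈ γ → ∃[ l ] (k < l × v ≡ swapPos k l u)

complementWord : ℕ → List Step → List ℕ
complementWord n γ = dWord (complementIn n (map label γ))

-- What holds at a vertex u of an increasing chain to w₀ whose preceding label is (k, b).
record ChainFacts (n : ℕ) (u : List ℕ) (γ : List Step) (k b : ℕ) : Set where
  field
    invariant : LabelInvariant n u k b
    edges : EdgesAtLabel γ
    val≡word : ∀ i → InRange n i → val u i ≡ applyWord (complementWord n γ) i
    inv≡length : inv u ≡ length (complementWord n γ)

ChainFacts-w₀ : ∀ n k b → ChainFacts n (w₀ n) [] k b
ChainFacts-w₀ n k b = record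
  { invariant = (λ p 1≤p _ p≤n → val-w₀ n p 1≤p p≤n) , λ 1≤k k≤n → inj₂ (val-w₀ n k 1≤k k≤n)
  ; edges = λ _ _ _ _ ()
  ; val≡word = λ i ri@(1≤i , i≤n) → +-cancelʳ-≡ i _ _ (trans (val-w₀ n i 1≤i i≤n)
      (sym (trans (cong (λ w → applyWord w i + i) (complementWord-[] n)) (proj₁ (applyRowsWord n n ≤-refl i ri) i≤n))))
  ; inv≡length = trans (inv-w₀ n) (sym (trans (cong length (dWord≡map-letter (complementIn n [])))
      (trans (length-map letter (complementIn n [])) (cong length (complementIn-[] n)))))
  }

ChainFacts-cons : ∀ {n u v k b j} k₁ b₁ (γ : List Step) → Perm n u → Perm n v →
  v ≡ swapPos k₁ j u → 1 ≤ k₁ → k₁ < j → j ≤ n → val u k₁ < val u j → NoValueBetween u k₁ j →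
  b₁ ≡ val u k₁ → (k , b) <ₗ (k₁ , b₁) → All ((k₁ , b₁) <ₗ_) (map label γ) →
  ChainFacts n v γ k₁ b₁ → ChainFacts n u ((u , (k₁ , b₁) , v) ∷ γ) k b
ChainFacts-cons (suc m) zero γ pu _ _ 1≤k₁ k₁<j j≤n _ _ b₁≡uk₁ _ _ _ =
  ⊥-elim (<-irrefl b₁≡uk₁
    (proj₁ (PermVals.val-InRange (permVals pu) (suc m) (1≤k₁ , ≤-trans (<⇒≤ k₁<j) j≤n))))
ChainFacts-cons {n} {u} {v} {k} {b} {j} (suc m) (suc e) γ pu pv v≡ 1≤k₁ k₁<j j≤n uk₁<uj between b₁≡uk₁ lab after
  facts =
  record { invariant = LabelInvariant-backward (permVals pu) v≡ 1≤k₁ k₁<j j≤n invariant b₁≡uk₁ lab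
         ; edges = edges′
         ; val≡word = val≡word′
         ; inv≡length = inv≡length′ }
  where
  open ChainFacts facts
  open SwapVals (permVals pu) v≡
  k₁ = suc m
  b₁ = suc e
  rk₁ : InRange n k₁
  rk₁ = 1≤k₁ , ≤-trans (<⇒≤ k₁<j) j≤n
  rj : InRange n j
  rj = ≤-trans 1≤k₁ (<⇒≤ k₁<j) , j≤n
  k+b≤n : suc m + suc e ≤ n
  k+b≤n = label-in-staircase (permVals pv) (proj₁ invariant) 1≤k₁ (proj₂ rk₁)
            (subst₂ _<_ (sym b₁≡uk₁) (sym (val-swap-i rk₁)) uk₁<uj)
  open ComplementAtLabel n m e k+b≤n (map label γ) after
    using (wordBefore; wordAfter; c; wordBefore-c; wordAfter-k₁; word-split; word-cons-split)
  γ′ = (u , (k₁ , b₁) , v) ∷ γ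
  edges′ : EdgesAtLabel γ′
  edges′ _ _ _ _ (here refl) = j , k₁<j , v≡
  edges′ u′ k′ b′ v′ (there e∈γ) = edges u′ k′ b′ v′ e∈γ
  v≡words : ∀ i → InRange n i → val v i ≡ applyWord wordBefore (tr c (suc c) (applyWord wordAfter i))
  v≡words i ri =
    trans (val≡word i ri) (trans (cong (λ w → applyWord w i) word-split) (applyWord-++ wordBefore (c ∷ wordAfter) i))
  wordAfter-j : applyWord wordAfter j ≡ suc c
  wordAfter-j = trans (sym (tr-involutive c (suc c) (applyWord wordAfter j)))
                      (trans (cong (tr c (suc c)) j↦c) (tr-left c (suc c)))
    where
    j↦c : tr c (suc c) (applyWord wordAfter j) ≡ c
    j↦c = applyWord-injective wordBefore
      (trans (sym (v≡words j rj)) (trans (val-swap-j rj) (trans (sym b₁≡uk₁) (sym wordBefore-c))))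
  val≡word′ : ∀ i → InRange n i → val u i ≡ applyWord (complementWord n γ′) i
  val≡word′ i ri = begin
    val u i                                         ≡⟨ cong (val u) (sym (tr-involutive k₁ j i)) ⟩
    val u (tr k₁ j (tr k₁ j i))                     ≡⟨ sym (val-swap (tr k₁ j i) (tr-InRange rk₁ rj ri)) ⟩
    val v (tr k₁ j i)                               ≡⟨ v≡words (tr k₁ j i) (tr-InRange rk₁ rj ri) ⟩
    applyWord wordBefore (tr c (suc c) (applyWord wordAfter (tr k₁ j i)))
      ≡⟨ cong (applyWord wordBefore) (tr-conjugate wordAfter k₁ j c i (<⇒≢ k₁<j) wordAfter-k₁ wordAfter-j) ⟩
    applyWord wordBefore (applyWord wordAfter i)    ≡⟨ sym (applyWord-++ wordBefore wordAfter i) ⟩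
    applyWord (wordBefore ++ wordAfter) i           ≡⟨ cong (λ w → applyWord w i) (sym word-cons-split) ⟩
    applyWord (complementWord n γ′) i               ∎
    where open ≡-Reasoning
  inv≡length′ : inv u ≡ length (complementWord n γ′)
  inv≡length′ = suc-injective (begin
    suc (inv u)                              ≡⟨ sym (inv-cover pu 1≤k₁ k₁<j j≤n uk₁<uj between) ⟩
    inv (swapPos k₁ j u)                     ≡⟨ cong inv (sym v≡) ⟩
    inv v                                    ≡⟨ inv≡length ⟩
    length (complementWord n γ)              ≡⟨ cong length word-split ⟩
    length (wordBefore ++ c ∷ wordAfter)     ≡⟨ length-++ wordBefore ⟩
    length wordBefore + suc (length wordAfter) ≡⟨ +-suc (length wordBefore) (length wordAfter) ⟩
    suc (length wordBefore + length wordAfter) ≡⟨ cong suc (sym (length-++ wordBefore)) ⟩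
    suc (length (wordBefore ++ wordAfter))   ≡⟨ cong (λ w → suc (length w)) (sym word-cons-split) ⟩
    suc (length (complementWord n γ′))       ∎)
    where open ≡-Reasoning

record CoverAt (n : ℕ) (u : List ℕ) (k₁ b₁ : ℕ) (v : List ℕ) : Set where
  field
    i j : ℕ
    1≤i : 1 ≤ i
    i<j : i < j
    j≤n : j ≤ n
    v≡ : v ≡ swapPos i j u
    ui<uj : val u i < val u j
    between : NoValueBetween u i j
    i≤k₁ : i ≤ k₁
    k₁<j : k₁ < j
    b₁≡ui : b₁ ≡ val u i

-- A labelled edge names its transposition twice (as a cover and as a labelled swap);
-- since u is injective both are the same transposition.
LabEdge⇒CoverAt : ∀ {n u k₁ b₁ v} → Perm n u → LabEdge n u (k₁ , b₁) v → Perm n v × CoverAt n u k₁ b₁ v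
LabEdge⇒CoverAt pu ((_ , pv , k , l , 1≤k , k<l , l≤n , v≡′ , uk<ul , between) ,
                   i , j , 1≤i , i<j , j≤n , v≡ , i≤k₁ , k₁<j , b₁≡ui , _)
  with swapPos-injective (permVals pu) (1≤i , ≤-trans (<⇒≤ i<j) j≤n) (≤-trans 1≤i (<⇒≤ i<j) , j≤n)
         (1≤k , ≤-trans (<⇒≤ k<l) l≤n) (≤-trans 1≤k (<⇒≤ k<l) , l≤n) i<j k<l (trans (sym v≡) v≡′)
... | refl , refl = pv , record { i = i ; j = j ; 1≤i = 1≤i ; i<j = i<j ; j≤n = j≤n ; v≡ = v≡ ; ui<uj = uk<ul
                                ; between = between ; i≤k₁ = i≤k₁ ; k₁<j = k₁<j ; b₁≡ui = b₁≡ui }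

chainFacts : ∀ {n u γ} k b → IsChain n u (w₀ n) γ → Linked _<ₗ_ ((k , b) ∷ map label γ) → Perm n u →
  ChainFacts n u γ k b
chainFacts {n} k b nil _ _ = ChainFacts-w₀ n k b
chainFacts k b (cons {kb = (k₁ , b₁)} {γ = γ} edge chain) (lab ∷ increasing) pu
  with LabEdge⇒CoverAt pu edge
... | pv , cover with chainFacts k₁ b₁ chain increasing pv
... | facts
  with edge-starts-at-label (permVals pu) v≡ 1≤i i<j j≤n ui<uj between i≤k₁ k₁<j (ChainFacts.invariant facts) b₁≡ui
  where open CoverAt cover
... | refl = ChainFacts-cons k₁ b₁ γ pu pv v≡ 1≤i i<j j≤n ui<uj between b₁≡ui lab (Linked⇒All increasing) facts
  where open CoverAt cover

-- The label (0, 0) precedes every label, and the invariant is vacuous for it.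
Linked-from-origin : ∀ {n u γ} → IsChain n u (w₀ n) γ → Linked _<ₗ_ (map label γ) →
  Linked _<ₗ_ ((0 , 0) ∷ map label γ)
Linked-from-origin nil _ = [-]
Linked-from-origin (cons (_ , _ , _ , 1≤i , _ , _ , _ , i≤k , _) _) increasing = fst< (≤-trans 1≤i i≤k) ∷ increasing

theorem2p4 : (n : ℕ) (w : List ℕ) → Perm n w → (γ : List Step) → IncreasingChain n w (w₀ n) γ →
    (∀ u k b v → (u , (k , b) , v) ∈ γ → ∃[ l ] (k < l × v ≡ swapPos k l u))
    × IsRCGraph n (complementIn n (map label γ))
theorem2p4 n w pw γ (chain , increasing) =
  edges , w , pw , w≡prodWord , sym inv≡length
  where
  open ChainFacts (chainFacts 0 0 chain (Linked-from-origin chain increasing) pw)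
  w≡prodWord : w ≡ prodWord n (complementWord n γ)
  w≡prodWord = ≡prodWord n (complementWord n γ) w (Perm-length pw) (complement-letters-valid n (map label γ)) val≡word
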